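{- Let $d_{n,k}$ denote the number of derangements of $[n]$ having exactly $k$ right-to-left minima. For $n\ge 3$, $$d_{n,n-2}=(n-3)+(n-2)^2,$$ and $$\sum_{n\ge 3}d_{n,n-2}x^{n-3}=\frac{1+2x-x^2}{(1-x)^3}.$$
   Context: A derangement of $[n]$ is a permutation $\sigma$ with no fixed points. A right-to-left minimum of $\sigma$ is a value $\sigma(i)$ such that $\sigma(i)<\sigma(k)$ for all $k>i$. -}

module Defs where

open import Data.Nat as ℕ using (ℕ; zero; suc)
open import Data.Integer as ℤ using (ℤ)
open import Data.Fin as Fin using (Fin)
open import Data.Fin.Properties using (all?)
open import Data.Vec using (Vec; []; _∷_; lookup)
open import Data.List using (List; []; _∷_; map; concatMap; filter; length; sum; upTo; allFin; foldr)
open import Data.Product using (_×_)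
open import Relation.Nullary using (¬_)
open import Relation.Nullary.Decidable using (_×-dec_; ¬?)
open import Relation.Unary using (Decidable)
open import Relation.Binary.PropositionalEquality using (_≡_)

-- A permutation of [n] is written in one-line notation as a vector
-- σ = (σ(0), …, σ(n-1)) of elements of Fin n (i.e. [n] relabelled 0..n-1)
-- which is injective.  (Positions and values are both Fin n.)

allVecs : (n m : ℕ) → List (Vec (Fin m) n)
allVecs zero    m = [] ∷ []
allVecs (suc n) m = concatMap (λ v → map (_∷ v) (allFin m)) (allVecs n m)

IsPerm : ∀ {n} → Vec (Fin n) n → Set
IsPerm {n} σ = ∀ (i j : Fin n) → lookup σ i ≡ lookup σ j → i ≡ j

isPerm? : ∀ {n} → Decidable (IsPerm {n})
isPerm? {n} σ = all? λ i → all? λ j → (lookup σ i Fin.≟ lookup σ j) Relation.Nullary.Decidable.→-dec (i Fin.≟ j)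

IsDerangement : ∀ {n} → Vec (Fin n) n → Set
IsDerangement {n} σ = ∀ (i : Fin n) → ¬ (lookup σ i ≡ i)

isDerangement? : ∀ {n} → Decidable (IsDerangement {n})
isDerangement? σ = all? λ i → ¬? (lookup σ i Fin.≟ i)

IsRLMinAt : ∀ {n} → Vec (Fin n) n → Fin n → Set
IsRLMinAt {n} σ i = ∀ (k : Fin n) → i Fin.< k → lookup σ i Fin.< lookup σ k

isRLMinAt? : ∀ {n} (σ : Vec (Fin n) n) → Decidable (IsRLMinAt σ)
isRLMinAt? σ i = all? λ k → (i Fin.<? k) Relation.Nullary.Decidable.→-dec (lookup σ i Fin.<? lookup σ k)

rlmin : ∀ {n} → Vec (Fin n) n → ℕ
rlmin {n} σ = length (filter (isRLMinAt? σ) (allFin n))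

IsCounted : (n k : ℕ) → Vec (Fin n) n → Set
IsCounted n k σ = IsPerm σ × IsDerangement σ × rlmin σ ≡ k

isCounted? : (n k : ℕ) → Decidable (IsCounted n k)
isCounted? n k σ = isPerm? σ ×-dec isDerangement? σ ×-dec (rlmin σ ℕ.≟ k)

d : ℕ → ℕ → ℕ
d n k = length (filter (isCounted? n k) (allVecs n n))

FPS : Set
FPS = ℕ → ℤ

_*ₛ_ : FPS → FPS → FPS
(f *ₛ g) m = foldr ℤ._+_ (ℤ.+ 0) (map (λ i → f i ℤ.* g (m ℕ.∸ i)) (upTo (suc m)))

poly : List ℤ → FPS
poly []       _       = ℤ.+ 0
poly (a ∷ as) zero    = a
poly (a ∷ as) (suc m) = poly as m

-- ∑_{n≥3} d_{n,n-2} x^{n-3} : coefficient of x^m is d_{m+3, m+1}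
Dseries : FPS
Dseries m = ℤ.+ (d (m ℕ.+ 3) (suc m))

-- A right-to-left minimum σ(i) satisfies σ(i) ≤ i, since the n − i values at
-- positions i, …, n − 1 are distinct and at least σ(i).  In a derangement it is
-- even σ(i) < i, so position 0 is never a minimum, and a derangement of
-- {0, …, n − 1} with n − 2 minima has exactly one further non-minimum position
-- P + 1.  The minima increase from left to right and lie below their positions,
-- which forces σ(j + 1) = j for j < P; after the gap the values are j − 1 up to
-- a threshold c and j beyond it, and n − 1 and c sit at positions 0 and P + 1 in
-- either order.  Counting the admissible triples (order, P, c) gives
-- (n − 3) + (n − 2)², and the generating function identity says that the third
-- difference of this quadratic in n vanishes.
module Submission where

open import Data.Empty using (⊥-elim)
open import Data.Fin using (Fin; zero; suc; toℕ; fromℕ<)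
open import Data.Fin.Properties using (toℕ-fromℕ<; fromℕ<-toℕ; toℕ-injective; toℕ<n; injective⇒≤)
  renaming (suc-injective to fin-suc-injective)
open import Data.Integer using (ℤ; +_; -_; 0ℤ; 1ℤ)
import Data.Integer as ℤ
open import Data.Integer.Properties using (pos-+; pos-*)
import Data.Integer.Tactic.RingSolver as ℤ-Solver
open import Data.List using (List; []; _∷_; _++_; map; foldr; upTo; allFin; concatMap; cartesianProductWith; filter; length)
import Data.List as List
open import Data.List.Properties
  using (map-cong; length-++; length-map; length-upTo; length-tabulate; filter-accept; filter-reject; filter-all; filter-complete)
open import Data.List.Membership.Propositional using (_∈_; _∉_)
open import Data.List.Membership.Propositional.Properties
  using (∈-map⁺; ∈-map⁻; ∈-++⁺ˡ; ∈-++⁺ʳ; ∈-++⁻; ∈-upTo⁺; ∈-upTo⁻; ∈-allFin; ∈-filter⁺; ∈-filter⁻; ∈-cartesianProductWith⁺)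
open import Data.List.Membership.Propositional.Properties.WithK using (unique∧set⇒bag)
open import Data.List.Relation.Binary.BagAndSetEquality using (∼bag⇒↭)
open import Data.List.Relation.Binary.Disjoint.Propositional using (Disjoint)
open import Data.List.Relation.Binary.Permutation.Propositional.Properties using (↭-length)
open import Data.List.Relation.Unary.All using (All; []; _∷_)
import Data.List.Relation.Unary.All as All
import Data.List.Relation.Unary.All.Properties as Allₚ
open import Data.List.Relation.Unary.AllPairs using ([]; _∷_)
open import Data.List.Relation.Unary.Any using (here; there)
open import Data.List.Relation.Unary.Unique.Propositional using (Unique)
import Data.List.Relation.Unary.Unique.Propositional.Properties as Unique
open import Data.Nat using (ℕ; zero; suc; _+_; _*_; _∸_; _^_; _<_; _≤_; z≤n; s≤s; s≤s⁻¹; z<s; pred; _≟_; _<?_; _≤?_; NonZero)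
open import Data.Nat.DivMod using (_mod_; _%_; m<n⇒m%n≡m)
open import Data.Nat.Properties
import Data.Nat.Tactic.RingSolver as ℕ-Solver
open import Data.Product using (_×_; _,_; proj₂; ∃; swap)
open import Data.Sum using (_⊎_; inj₁; inj₂; [_,_]′)
open import Data.Vec using (Vec; []; _∷_; lookup; tabulate)
open import Data.Vec.Properties using (∷-injective; lookup∘tabulate; tabulate∘lookup; tabulate-cong)
open import Function using (flip; _∘_; _⟨_⟩_)
open import Function.Bundles using (mk⇔)
open import Relation.Binary using (tri<; tri≈; tri>)
open import Relation.Binary.PropositionalEquality
open import Relation.Nullary using (¬_; yes; no)
open import Relation.Unary using (Decidable)

open import Defs

-- Counting by enumeration

module _ {A : Set} {P : A → Set} (P? : Decidable P) where

  length-filter≡length-enumeration :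
    ∀ {xs ys : List A} → Unique xs → (∀ x → x ∈ xs) → Unique ys →
    (∀ {y} → y ∈ ys → P y) → (∀ {y} → P y → y ∈ ys) →
    length (filter P? xs) ≡ length ys
  length-filter≡length-enumeration {xs} xs! xs-full ys! sound complete =
    ↭-length (∼bag⇒↭ (unique∧set⇒bag (Unique.filter⁺ P? xs!) ys!
      (mk⇔ (λ y∈ → complete (proj₂ (∈-filter⁻ P? {xs = xs} y∈)))
           (λ y∈ → ∈-filter⁺ P? (xs-full _) (sound y∈)))))

  length-filter-tabulate : ∀ {n} (h : Fin n → A) → (∀ i → P (h i)) →
                           length (filter P? (List.tabulate h)) ≡ n
  length-filter-tabulate h Ph =
    trans (cong length (filter-all P? (Allₚ.tabulate⁺ Ph))) (length-tabulate h)

  length-filter-tabulate⁻ : ∀ {n} (h : Fin n → A) →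
                            length (filter P? (List.tabulate h)) ≡ n → ∀ i → P (h i)
  length-filter-tabulate⁻ h eq = Allₚ.tabulate⁻ (subst (All P)
    (filter-complete P? (trans eq (sym (length-tabulate h)))) (Allₚ.all-filter P? (List.tabulate h)))

  length-filter-tabulate-allButOne :
    ∀ {n} (h : Fin n → A) (p : Fin n) → ¬ P (h p) → (∀ i → i ≢ p → P (h i)) →
    suc (length (filter P? (List.tabulate h))) ≡ n
  length-filter-tabulate-allButOne {suc n} h zero ¬Php Ph =
    cong (suc ∘ length) (filter-reject P? ¬Php)
    ⟨ trans ⟩ cong suc (length-filter-tabulate (h ∘ suc) (λ i → Ph (suc i) λ ()))
  length-filter-tabulate-allButOne {suc n} h (suc p) ¬Php Ph =
    cong (suc ∘ length) (filter-accept P? (Ph zero λ ()))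
    ⟨ trans ⟩ cong suc (length-filter-tabulate-allButOne (h ∘ suc) p ¬Php
                          (λ i i≢p → Ph (suc i) (i≢p ∘ fin-suc-injective)))

  length-filter-tabulate-allButOne⁻ :
    ∀ {n} (h : Fin n → A) → suc (length (filter P? (List.tabulate h))) ≡ n →
    ∃ λ p → ¬ P (h p) × (∀ i → i ≢ p → P (h i))
  length-filter-tabulate-allButOne⁻ {suc n} h eq with P? (h zero)
  ... | yes Ph0
    with p , ¬Php , Ph ← length-filter-tabulate-allButOne⁻ (h ∘ suc) (cong pred eq) =
      suc p , ¬Php , λ { zero _ → Ph0 ; (suc i) i≢p → Ph i (i≢p ∘ cong suc) }
  ... | no ¬Ph0 = zero , ¬Ph0 , λ
    { zero 0≢0 → ⊥-elim (0≢0 refl)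
    ; (suc i) _ → length-filter-tabulate⁻ (h ∘ suc) (cong pred eq) i }

map⁺-uniqueOn : ∀ {A B : Set} {f : A → B} {xs} →
                (∀ {x y} → x ∈ xs → y ∈ xs → f x ≡ f y → x ≡ y) → Unique xs → Unique (map f xs)
map⁺-uniqueOn {xs = []}     _     []          = []
map⁺-uniqueOn {xs = x ∷ xs} f-inj (x∉xs ∷ xs!) =
  Allₚ.map⁺ (All.tabulate λ y∈ fx≡fy → All.lookup x∉xs y∈ (f-inj (here refl) (there y∈) fx≡fy))
  ∷ map⁺-uniqueOn (λ x∈ y∈ → f-inj (there x∈) (there y∈)) xs!

concatMap-map≡cartesianProductWith :
  ∀ {A B C : Set} (f : A → B → C) xs ys →
  concatMap (λ x → map (f x) ys) xs ≡ cartesianProductWith f xs ys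
concatMap-map≡cartesianProductWith f []       ys = refl
concatMap-map≡cartesianProductWith f (x ∷ xs) ys =
  cong (map (f x) ys ++_) (concatMap-map≡cartesianProductWith f xs ys)

allVecs-suc : ∀ n m → allVecs (suc n) m ≡ cartesianProductWith (flip _∷_) (allVecs n m) (allFin m)
allVecs-suc n m = concatMap-map≡cartesianProductWith (flip _∷_) (allVecs n m) (allFin m)

∈-allVecs : ∀ {n m} (v : Vec (Fin m) n) → v ∈ allVecs n m
∈-allVecs []      = here refl
∈-allVecs {suc n} {m} (x ∷ v) = subst ((x ∷ v) ∈_) (sym (allVecs-suc n m))
  (∈-cartesianProductWith⁺ (flip _∷_) (∈-allVecs v) (∈-allFin x))

allVecs-unique : ∀ n m → Unique (allVecs n m)
allVecs-unique zero    m = [] ∷ []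
allVecs-unique (suc n) m = subst Unique (sym (allVecs-suc n m))
  (Unique.cartesianProductWith⁺ (flip _∷_) (swap ∘ ∷-injective)
    (allVecs-unique n m) (Unique.allFin⁺ m))

-- Permutations as functions on ℕ

InjectiveBelow : ℕ → (ℕ → ℕ) → Set
InjectiveBelow n f = ∀ {i j} → i < n → j < n → f i ≡ f j → i ≡ j

injectiveBelow⇒≤ : ∀ {L K} (f : ℕ → ℕ) → (∀ {i} → i < L → f i < K) → InjectiveBelow L f → L ≤ K
injectiveBelow⇒≤ {L} {K} f f<K f-inj = injective⇒≤ {f = f′} λ {i} {j} eq →
  toℕ-injective (f-inj (toℕ<n i) (toℕ<n j)
    (sym (toℕ-fromℕ< (f<K (toℕ<n i))) ⟨ trans ⟩ cong toℕ eq ⟨ trans ⟩ toℕ-fromℕ< (f<K (toℕ<n j))))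
  where
  f′ : Fin L → Fin K
  f′ i = fromℕ< (f<K (toℕ<n i))

record IsPermℕ (n : ℕ) (f : ℕ → ℕ) : Set where
  field
    bounded   : ∀ {i} → i < n → f i < n
    injective : InjectiveBelow n f

IsDerangementℕ : ℕ → (ℕ → ℕ) → Set
IsDerangementℕ n f = ∀ {i} → i < n → f i ≢ i

IsRLMinℕ : ℕ → (ℕ → ℕ) → ℕ → Set
IsRLMinℕ n f i = ∀ {k} → k < n → i < k → f i < f k

rlMin⇒≤ : ∀ {n f i} → IsPermℕ n f → i < n → IsRLMinℕ n f i → f i ≤ i
rlMin⇒≤ {n} {f} {i} perm i<n min =
  ∸-cancelʳ-≤ (<⇒≤ (bounded i<n)) (injectiveBelow⇒≤ shifted shifted< shifted-inj)
  where
  open IsPermℕ perm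
  shifted : ℕ → ℕ
  shifted k = f (i + k) ∸ f i
  i+k<n : ∀ {k} → k < n ∸ i → i + k < n
  i+k<n k< = subst (_ <_) (m+[n∸m]≡n (<⇒≤ i<n)) (+-monoʳ-< i k<)
  f-i≤ : ∀ {k} → k < n ∸ i → f i ≤ f (i + k)
  f-i≤ {zero}  _  = ≤-reflexive (cong f (sym (+-identityʳ i)))
  f-i≤ {suc k} k< = <⇒≤ (min (i+k<n k<) (m<m+n i z<s))
  shifted< : ∀ {k} → k < n ∸ i → shifted k < n ∸ f i
  shifted< k< = ∸-monoˡ-< (bounded (i+k<n k<)) (f-i≤ k<)
  shifted-inj : InjectiveBelow (n ∸ i) shifted
  shifted-inj k< k′< eq = +-cancelˡ-≡ i _ _
    (injective (i+k<n k<) (i+k<n k′<) (∸-cancelʳ-≡ (f-i≤ k<) (f-i≤ k′<) eq))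

rlMin⇒< : ∀ {n f i} → IsPermℕ n f → IsDerangementℕ n f → i < n → IsRLMinℕ n f i → f i < i
rlMin⇒< perm der i<n min = ≤∧≢⇒< (rlMin⇒≤ perm i<n min) (der i<n)

¬isRLMinℕ-zero : ∀ {n f} → IsPermℕ n f → IsDerangementℕ n f → 0 < n → ¬ IsRLMinℕ n f 0
¬isRLMinℕ-zero perm der 0<n min = n≮0 (rlMin⇒< perm der 0<n min)

module Represents {n} (σ : Vec (Fin n) n) (f : ℕ → ℕ)
                  (σ≗f : ∀ k → toℕ (lookup σ k) ≡ f (toℕ k)) where

  f≡lookup : ∀ {i} (i<n : i < n) → f i ≡ toℕ (lookup σ (fromℕ< i<n))
  f≡lookup i<n = cong f (sym (toℕ-fromℕ< i<n)) ⟨ trans ⟩ sym (σ≗f (fromℕ< i<n))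

  f≡f⇒lookup≡lookup : ∀ {i j} (i<n : i < n) (j<n : j < n) → f i ≡ f j →
                      lookup σ (fromℕ< i<n) ≡ lookup σ (fromℕ< j<n)
  f≡f⇒lookup≡lookup i<n j<n eq = toℕ-injective (sym (f≡lookup i<n) ⟨ trans ⟩ eq ⟨ trans ⟩ f≡lookup j<n)

  isPermℕ : IsPerm σ → IsPermℕ n f
  isPermℕ σ-inj = record
    { bounded   = λ i<n → subst (_< n) (sym (f≡lookup i<n)) (toℕ<n _)
    ; injective = λ i<n j<n eq → sym (toℕ-fromℕ< i<n)
        ⟨ trans ⟩ cong toℕ (σ-inj _ _ (f≡f⇒lookup≡lookup i<n j<n eq)) ⟨ trans ⟩ toℕ-fromℕ< j<n
    }

  isPerm : InjectiveBelow n f → IsPerm σ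
  isPerm f-inj i j eq =
    toℕ-injective (f-inj (toℕ<n i) (toℕ<n j) (sym (σ≗f i) ⟨ trans ⟩ cong toℕ eq ⟨ trans ⟩ σ≗f j))

  isDerangementℕ : IsDerangement σ → IsDerangementℕ n f
  isDerangementℕ σ-der i<n fi≡i =
    σ-der (fromℕ< i<n) (toℕ-injective (sym (f≡lookup i<n) ⟨ trans ⟩ fi≡i ⟨ trans ⟩ sym (toℕ-fromℕ< i<n)))

  isDerangement : IsDerangementℕ n f → IsDerangement σ
  isDerangement f-der i σi≡i = f-der (toℕ<n i) (sym (σ≗f i) ⟨ trans ⟩ cong toℕ σi≡i)

  isRLMinℕ : ∀ {i} → IsRLMinAt σ i → IsRLMinℕ n f (toℕ i)
  isRLMinℕ {i} min k<n i<k = subst₂ _<_ (σ≗f i) (sym (f≡lookup k<n))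
    (min (fromℕ< k<n) (subst (toℕ i <_) (sym (toℕ-fromℕ< k<n)) i<k))

  isRLMinAt : ∀ {i} → IsRLMinℕ n f (toℕ i) → IsRLMinAt σ i
  isRLMinAt {i} min k i<k = subst₂ _<_ (sym (σ≗f i)) (sym (σ≗f k)) (min (toℕ<n k) i<k)

module _ {k} (σ : Vec (Fin (suc k)) (suc k)) (¬min₀ : ¬ IsRLMinAt σ zero) where

  rlmin≡ : (p : Fin k) → ¬ IsRLMinAt σ (suc p) → (∀ i → i ≢ p → IsRLMinAt σ (suc i)) → suc (rlmin σ) ≡ k
  rlmin≡ p ¬minₚ min = cong (suc ∘ length) (filter-reject (isRLMinAt? σ) ¬min₀)
    ⟨ trans ⟩ length-filter-tabulate-allButOne (isRLMinAt? σ) suc p ¬minₚ min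

  rlmin≡⁻ : suc (rlmin σ) ≡ k → ∃ λ p → ¬ IsRLMinAt σ (suc p) × (∀ i → i ≢ p → IsRLMinAt σ (suc i))
  rlmin≡⁻ eq = length-filter-tabulate-allButOne⁻ (isRLMinAt? σ) suc
    (sym (cong (suc ∘ length) (filter-reject (isRLMinAt? σ) ¬min₀)) ⟨ trans ⟩ eq)

toFun : ∀ {n} → Vec (Fin n) n → ℕ → ℕ
toFun {n} σ i with i <? n
... | yes i<n = toℕ (lookup σ (fromℕ< i<n))
... | no  _   = 0

toℕ-lookup-toFun : ∀ {n} (σ : Vec (Fin n) n) k → toℕ (lookup σ k) ≡ toFun σ (toℕ k)
toℕ-lookup-toFun {n} σ k with toℕ k <? n
... | yes k<n = cong (toℕ ∘ lookup σ) (sym (fromℕ<-toℕ k k<n))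
... | no  k≮n = ⊥-elim (k≮n (toℕ<n k))

fromFun : ∀ n .{{_ : NonZero n}} → (ℕ → ℕ) → Vec (Fin n) n
fromFun n f = tabulate (λ i → f (toℕ i) mod n)

toℕ-lookup-fromFun : ∀ {n} .{{_ : NonZero n}} {f} → (∀ {i} → i < n → f i < n) →
                     ∀ k → toℕ (lookup (fromFun n f) k) ≡ f (toℕ k)
toℕ-lookup-fromFun {n} {f = f} f<n k = begin
  toℕ (lookup (fromFun n f) k) ≡⟨ cong toℕ (lookup∘tabulate _ k) ⟩
  toℕ (f (toℕ k) mod n)        ≡⟨ toℕ-fromℕ< _ ⟩
  f (toℕ k) % n                ≡⟨ m<n⇒m%n≡m (f<n (toℕ<n k)) ⟩
  f (toℕ k)                    ∎
  where open ≡-Reasoning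

≡fromFun : ∀ {n} .{{_ : NonZero n}} (σ : Vec (Fin n) n) {f} →
           (∀ k → toℕ (lookup σ k) ≡ f (toℕ k)) → σ ≡ fromFun n f
≡fromFun {n} σ {f} σ≗f = sym (tabulate∘lookup σ) ⟨ trans ⟩ tabulate-cong λ k → toℕ-injective (begin
  toℕ (lookup σ k)        ≡⟨ m<n⇒m%n≡m (toℕ<n (lookup σ k)) ⟨
  toℕ (lookup σ k) % n    ≡⟨ cong (_% n) (σ≗f k) ⟩
  f (toℕ k) % n           ≡⟨ toℕ-fromℕ< _ ⟨
  toℕ (f (toℕ k) mod n)   ∎)
  where open ≡-Reasoning

-- The permutations with two non-minima

-- rest P c j is the value at position j + 1 ≠ P + 1: the values below n ∸ 1
-- other than c, in increasing order, fill positions 1, …, n ∸ 1 except P + 1.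
rest : (P c j : ℕ) → ℕ
rest P c j with j <? P | j ≤? c
... | yes _ | _     = j
... | no  _ | yes _ = pred j
... | no  _ | no  _ = j

rest-< : ∀ {P c j} → j < P → rest P c j ≡ j
rest-< {P} {c} {j} j<P with j <? P
... | yes _   = refl
... | no  j≮P = ⊥-elim (j≮P j<P)

rest-shifted : ∀ {P c k} → P ≤ k → k < c → rest P c (suc k) ≡ k
rest-shifted {P} {c} {k} P≤k k<c with suc k <? P | suc k ≤? c
... | yes k<P | _       = ⊥-elim (<⇒≱ k<P (≤-trans P≤k (n≤1+n k)))
... | no  _   | yes _   = refl
... | no  _   | no  k≮c = ⊥-elim (k≮c k<c)

rest-> : ∀ {P c j} → c < j → rest P c j ≡ j
rest-> {P} {c} {j} c<j with j <? P | j ≤? c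
... | yes _ | _       = refl
... | no  _ | yes j≤c = ⊥-elim (<⇒≱ c<j j≤c)
... | no  _ | no  _   = refl

data Region (P c : ℕ) : ℕ → Set where
  before  : ∀ {j} → j < P → Region P c j
  shifted : ∀ {k} → P ≤ k → k < c → Region P c (suc k)
  after   : ∀ {j} → P < j → c < j → Region P c j

region : ∀ P c {j} → j ≢ P → Region P c j
region P c {j} j≢P with <-cmp j P
... | tri< j<P _ _ = before j<P
... | tri≈ _ j≡P _ = ⊥-elim (j≢P j≡P)
region P c {suc k} j≢P | tri> _ _ (s≤s P≤k) with suc k ≤? c
... | yes k<c = shifted P≤k k<c
... | no  k≮c = after (s≤s P≤k) (≰⇒> k≮c)

rest≤ : ∀ P c {j} → j ≢ P → rest P c j ≤ j
rest≤ P c j≢P with region P c j≢P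
... | before j<P      = ≤-reflexive (rest-< {c = c} j<P)
... | shifted P≤k k<c = ≤-reflexive (rest-shifted P≤k k<c) ⟨ ≤-trans ⟩ n≤1+n _
... | after _ c<j     = ≤-reflexive (rest-> {P = P} c<j)

rest≢c : ∀ {P c j} → P ≤ c → j ≢ P → rest P c j ≢ c
rest≢c {P} {c} P≤c j≢P with region P c j≢P
... | before j<P      = subst (_≢ c) (sym (rest-< {c = c} j<P)) (<⇒≢ (<-≤-trans j<P P≤c))
... | shifted P≤k k<c = subst (_≢ c) (sym (rest-shifted P≤k k<c)) (<⇒≢ k<c)
... | after _ c<j     = subst (_≢ c) (sym (rest-> {P = P} c<j)) (>⇒≢ c<j)

rest-strictMono : ∀ {P c j k} → j ≢ P → k ≢ P → j < k → rest P c j < rest P c k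
rest-strictMono {P} {c} j≢P k≢P j<k with region P c j≢P | region P c k≢P
... | _ | before k<P = subst₂ _<_ (sym (rest-< {c = c} (<-trans j<k k<P))) (sym (rest-< {c = c} k<P)) j<k
... | before j<P | shifted P≤k k<c =
  subst₂ _<_ (sym (rest-< {c = c} j<P)) (sym (rest-shifted P≤k k<c)) (<-≤-trans j<P P≤k)
... | shifted P≤j _ | shifted P≤k k<c =
  subst₂ _<_ (sym (rest-shifted P≤j (<-trans (s≤s⁻¹ j<k) k<c))) (sym (rest-shifted P≤k k<c)) (s≤s⁻¹ j<k)
... | after _ c<j | shifted _ k<c = ⊥-elim (<⇒≱ k<c (s≤s⁻¹ (<-trans c<j j<k)))
... | _ | after _ c<k = <-≤-trans (≤-<-trans (rest≤ P c j≢P) j<k) (≤-reflexive (sym (rest-> {P = P} c<k)))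

rest-injective : ∀ {P c j k} → j ≢ P → k ≢ P → rest P c j ≡ rest P c k → j ≡ k
rest-injective {j = j} {k} j≢P k≢P eq with <-cmp j k
... | tri< j<k _ _ = ⊥-elim (<⇒≢ (rest-strictMono j≢P k≢P j<k) eq)
... | tri≈ _ j≡k _ = j≡k
... | tri> _ _ k<j = ⊥-elim (>⇒≢ (rest-strictMono k≢P j≢P k<j) eq)

family : (x y P c : ℕ) → ℕ → ℕ
family x y P c zero    = x
family x y P c (suc j) with j ≟ P
... | yes _ = y
... | no  _ = rest P c j

family-gap : ∀ x y P c → family x y P c (suc P) ≡ y
family-gap x y P c with P ≟ P
... | yes _   = refl
... | no  P≢P = ⊥-elim (P≢P refl)

family-regular : ∀ x y P c {j} → j ≢ P → family x y P c (suc j) ≡ rest P c j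
family-regular x y P c {j} j≢P with j ≟ P
... | yes j≡P = ⊥-elim (j≢P j≡P)
... | no  _   = refl

data Position (P : ℕ) : ℕ → Set where
  origin  : Position P zero
  gap     : Position P (suc P)
  regular : ∀ {j} → j ≢ P → Position P (suc j)

position : ∀ P i → Position P i
position P zero    = origin
position P (suc j) with j ≟ P
... | yes refl = gap
... | no  j≢P  = regular j≢P

-- For n = m + 3: the positions that are not right-to-left minima are 0 and
-- suc P, carrying the values n ∸ 1 and c (in this order for maxFirst, swapped
-- for maxSecond); the other values fill the other positions increasingly.
data Shape : Set where
  maxFirst maxSecond : (P c : ℕ) → Shape

Valid : ℕ → Shape → Set
Valid m (maxFirst  P c) = 2 + P ≤ c × c ≤ suc m
Valid m (maxSecond P c) = 1 ≤ c × P ≤ c × c ≤ suc m × P ≤ m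

gapOf otherOf : Shape → ℕ
gapOf (maxFirst  P _) = P
gapOf (maxSecond P _) = P
otherOf (maxFirst  _ c) = c
otherOf (maxSecond _ c) = c

module _ (m : ℕ) where

  firstOf secondOf : Shape → ℕ
  firstOf (maxFirst  _ _) = 2 + m
  firstOf (maxSecond _ c) = c
  secondOf (maxFirst  _ c) = c
  secondOf (maxSecond _ _) = 2 + m

  shapeFun : Shape → ℕ → ℕ
  shapeFun s = family (firstOf s) (secondOf s) (gapOf s) (otherOf s)

  shapeFun-gap : ∀ s → shapeFun s (suc (gapOf s)) ≡ secondOf s
  shapeFun-gap s = family-gap (firstOf s) (secondOf s) (gapOf s) (otherOf s)

  shapeFun-regular : ∀ s {j} → j ≢ gapOf s → shapeFun s (suc j) ≡ rest (gapOf s) (otherOf s) j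
  shapeFun-regular s = family-regular (firstOf s) (secondOf s) (gapOf s) (otherOf s)

  IsCorner : Shape → ℕ → Set
  IsCorner s v = v ≡ otherOf s ⊎ v ≡ 2 + m

  firstOf-corner : ∀ s → IsCorner s (firstOf s)
  firstOf-corner (maxFirst  _ _) = inj₂ refl
  firstOf-corner (maxSecond _ _) = inj₁ refl

  secondOf-corner : ∀ s → IsCorner s (secondOf s)
  secondOf-corner (maxFirst  _ _) = inj₁ refl
  secondOf-corner (maxSecond _ _) = inj₂ refl

module _ {m : ℕ} where

  gap≤other : ∀ s → Valid m s → gapOf s ≤ otherOf s
  gap≤other (maxFirst  P _) (P+2≤c , _)   = ≤-trans (n≤1+n P) (≤-trans (n≤1+n (suc P)) P+2≤c)
  gap≤other (maxSecond _ _) (_ , P≤c , _) = P≤c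

  other<top : ∀ s → Valid m s → otherOf s < 2 + m
  other<top (maxFirst  _ _) (_ , c≤1+m)         = s≤s c≤1+m
  other<top (maxSecond _ _) (_ , _ , c≤1+m , _) = s≤s c≤1+m

  gap≤ : ∀ s → Valid m s → gapOf s ≤ m
  gap≤ (maxFirst  P _) (P+2≤c , c≤1+m)   = s≤s⁻¹ (≤-trans (n≤1+n (suc P)) (≤-trans P+2≤c c≤1+m))
  gap≤ (maxSecond _ _) (_ , _ , _ , P≤m) = P≤m

  1+gap<n : ∀ s → Valid m s → suc (gapOf s) < 3 + m
  1+gap<n s v = s≤s (s≤s (m≤n⇒m≤1+n (gap≤ s v)))

  firstOf≢0 : ∀ s → Valid m s → firstOf m s ≢ 0
  firstOf≢0 (maxFirst  _ _) _           = λ ()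
  firstOf≢0 (maxSecond _ _) (1≤c , _) = >⇒≢ 1≤c

  secondOf≢1+gap : ∀ s → Valid m s → secondOf m s ≢ suc (gapOf s)
  secondOf≢1+gap (maxFirst  _ _) (P+2≤c , _)       = >⇒≢ P+2≤c
  secondOf≢1+gap (maxSecond _ _) (_ , _ , _ , P≤m) = >⇒≢ (s≤s (s≤s P≤m))

  firstOf≢secondOf : ∀ s → Valid m s → firstOf m s ≢ secondOf m s
  firstOf≢secondOf s@(maxFirst  _ _) v = >⇒≢ (other<top s v)
  firstOf≢secondOf s@(maxSecond _ _) v = <⇒≢ (other<top s v)

  secondOf≢gap : ∀ s → Valid m s → secondOf m s ≢ gapOf s
  secondOf≢gap (maxFirst  _ _) (P+2≤c , _) = >⇒≢ (<-trans (n<1+n _) P+2≤c)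
  secondOf≢gap s@(maxSecond _ _) v           = >⇒≢ (≤-trans (s≤s (gap≤ s v)) (n≤1+n _))

  gap≤secondOf : ∀ s → Valid m s → gapOf s ≤ secondOf m s
  gap≤secondOf s@(maxFirst  _ _) v = gap≤other s v
  gap≤secondOf s@(maxSecond _ _) v = ≤-trans (gap≤ s v) (≤-trans (n≤1+n m) (n≤1+n (suc m)))

  restAfterGap<secondOf : ∀ s → Valid m s → rest (gapOf s) (otherOf s) (suc (gapOf s)) < secondOf m s
  restAfterGap<secondOf (maxFirst  P c) (P+2≤c , _) = subst (_< c) (sym (rest-shifted ≤-refl P<c)) P<c
    where
    P<c : P < c
    P<c = ≤-trans (n≤1+n (suc P)) P+2≤c
  restAfterGap<secondOf s@(maxSecond P c) v = s≤s (≤-trans (rest≤ P c (>⇒≢ ≤-refl)) (s≤s (gap≤ s v)))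

module ShapeFunProperties (m : ℕ) (s : Shape) (valid : Valid m s) where

  private
    n P c y : ℕ
    n = 3 + m
    P = gapOf s
    c = otherOf s
    y = secondOf m s
    f : ℕ → ℕ
    f = shapeFun m s

    f-gap : f (suc P) ≡ y
    f-gap = shapeFun-gap m s

    f-regular : ∀ {j} → j ≢ P → f (suc j) ≡ rest P c j
    f-regular = shapeFun-regular m s

    corner<n : ∀ {v} → IsCorner m s v → v < n
    corner<n (inj₁ refl) = <-trans (other<top s valid) (n<1+n _)
    corner<n (inj₂ refl) = n<1+n _

    rest<top : ∀ {j} → j ≢ P → suc j < n → rest P c j < 2 + m
    rest<top j≢P j<n = ≤-<-trans (rest≤ P c j≢P) (s≤s⁻¹ j<n)

    regular≢corner : ∀ {j v} → j ≢ P → suc j < n → IsCorner m s v → f (suc j) ≢ v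
    regular≢corner j≢P j<n (inj₁ refl) = subst (_≢ c) (sym (f-regular j≢P)) (rest≢c (gap≤other s valid) j≢P)
    regular≢corner j≢P j<n (inj₂ refl) = subst (_≢ 2 + m) (sym (f-regular j≢P)) (<⇒≢ (rest<top j≢P j<n))

  bounded : ∀ {i} → i < n → f i < n
  bounded {i} i<n with position P i
  ... | origin      = corner<n (firstOf-corner m s)
  ... | gap         = subst (_< n) (sym f-gap) (corner<n (secondOf-corner m s))
  ... | regular j≢P = subst (_< n) (sym (f-regular j≢P)) (<-trans (rest<top j≢P i<n) (n<1+n _))

  injective : InjectiveBelow n f
  injective {i} {k} i<n k<n eq with position P i | position P k
  ... | origin | origin = refl
  ... | gap    | gap    = refl
  ... | origin | gap    = ⊥-elim (firstOf≢secondOf s valid (eq ⟨ trans ⟩ f-gap))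
  ... | gap    | origin = ⊥-elim (firstOf≢secondOf s valid (sym eq ⟨ trans ⟩ f-gap))
  ... | regular i≢P | origin = ⊥-elim (regular≢corner i≢P i<n (firstOf-corner m s) eq)
  ... | origin | regular k≢P = ⊥-elim (regular≢corner k≢P k<n (firstOf-corner m s) (sym eq))
  ... | regular i≢P | gap    = ⊥-elim (regular≢corner i≢P i<n (secondOf-corner m s) (eq ⟨ trans ⟩ f-gap))
  ... | gap    | regular k≢P = ⊥-elim (regular≢corner k≢P k<n (secondOf-corner m s) (sym eq ⟨ trans ⟩ f-gap))
  ... | regular j≢P | regular j′≢P =
    cong suc (rest-injective j≢P j′≢P (sym (f-regular j≢P) ⟨ trans ⟩ eq ⟨ trans ⟩ f-regular j′≢P))

  isPermℕ : IsPermℕ n f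
  isPermℕ = record { bounded = bounded ; injective = injective }

  isDerangementℕ : IsDerangementℕ n f
  isDerangementℕ {i} _ with position P i
  ... | origin      = firstOf≢0 s valid
  ... | gap         = secondOf≢1+gap s valid ∘ (sym f-gap ⟨ trans ⟩_)
  ... | regular j≢P = <⇒≢ (s≤s (rest≤ P c j≢P)) ∘ (sym (f-regular j≢P) ⟨ trans ⟩_)

  regular-isRLMin : ∀ {j} → j ≢ P → IsRLMinℕ n f (suc j)
  regular-isRLMin {j} j≢P {k} _ j<k with position P k
  ... | origin      = ⊥-elim (n≮0 j<k)
  ... | gap         = subst₂ _<_ (sym (f-regular j≢P ⟨ trans ⟩ rest-< (s≤s⁻¹ j<k))) (sym f-gap)
                        (<-≤-trans (s≤s⁻¹ j<k) (gap≤secondOf s valid))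
  ... | regular k≢P = subst₂ _<_ (sym (f-regular j≢P)) (sym (f-regular k≢P))
                        (rest-strictMono j≢P k≢P (s≤s⁻¹ j<k))

  gap-¬isRLMin : ¬ IsRLMinℕ n f (suc P)
  gap-¬isRLMin min = <-asym (min (s≤s (s≤s (s≤s (gap≤ s valid)))) ≤-refl)
    (subst₂ _<_ (sym (f-regular 1+n≢n)) (sym f-gap) (restAfterGap<secondOf s valid))

module _ {m : ℕ} where

  private
    n : ℕ
    n = 3 + m

  shapeFun-differ-at-gap : ∀ s s′ → Valid m s → gapOf s < gapOf s′ →
                           shapeFun m s (suc (gapOf s)) ≢ shapeFun m s′ (suc (gapOf s))
  shapeFun-differ-at-gap s s′ v P<P′ eq = secondOf≢gap s v (begin
    secondOf m s                               ≡⟨ shapeFun-gap m s ⟨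
    shapeFun m s (suc (gapOf s))               ≡⟨ eq ⟩
    shapeFun m s′ (suc (gapOf s))              ≡⟨ shapeFun-regular m s′ (<⇒≢ P<P′) ⟩
    rest (gapOf s′) (otherOf s′) (gapOf s)     ≡⟨ rest-< {c = otherOf s′} P<P′ ⟩
    gapOf s                                    ∎)
    where open ≡-Reasoning

  shapeFun-injective : ∀ s s′ → Valid m s → Valid m s′ →
                       (∀ {i} → i < n → shapeFun m s i ≡ shapeFun m s′ i) → s ≡ s′
  shapeFun-injective s s′ v v′ s≗s′ with <-cmp (gapOf s) (gapOf s′)
  ... | tri< P<P′ _ _ = ⊥-elim (shapeFun-differ-at-gap s s′ v P<P′ (s≗s′ (1+gap<n s v)))
  ... | tri> _ _ P′<P = ⊥-elim (shapeFun-differ-at-gap s′ s v′ P′<P (sym (s≗s′ (1+gap<n s′ v′))))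
  shapeFun-injective (maxFirst P c) (maxFirst P c′) v v′ s≗s′ | tri≈ _ refl _ =
    cong (maxFirst P) (sym (shapeFun-gap m (maxFirst P c)) ⟨ trans ⟩ s≗s′ (1+gap<n (maxFirst P c) v)
                       ⟨ trans ⟩ shapeFun-gap m (maxFirst P c′))
  shapeFun-injective (maxSecond P c) (maxSecond P c′) v v′ s≗s′ | tri≈ _ refl _ =
    cong (maxSecond P) (s≗s′ z<s)
  shapeFun-injective (maxFirst _ _) s′@(maxSecond _ _) v v′ s≗s′ | tri≈ _ _ _ =
    ⊥-elim (>⇒≢ (other<top s′ v′) (s≗s′ z<s))
  shapeFun-injective s@(maxSecond _ _) (maxFirst _ _) v v′ s≗s′ | tri≈ _ _ _ =
    ⊥-elim (<⇒≢ (other<top s v) (s≗s′ z<s))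

-- Every such permutation has this form

module ForcedShape (m : ℕ) {f : ℕ → ℕ}
  (perm : IsPermℕ (3 + m) f) (der : IsDerangementℕ (3 + m) f)
  {P : ℕ} (P<n : suc P < 3 + m) (gap-¬isRLMin : ¬ IsRLMinℕ (3 + m) f (suc P))
  (regular-isRLMin : ∀ {j} → j ≢ P → suc j < 3 + m → IsRLMinℕ (3 + m) f (suc j)) where

  private
    n M : ℕ
    n = 3 + m
    M = 2 + m
    open IsPermℕ perm

  regular≤ : ∀ {j} → j ≢ P → suc j < n → f (suc j) ≤ j
  regular≤ j≢P j<n = s≤s⁻¹ (rlMin⇒< perm der j<n (regular-isRLMin j≢P j<n))

  regular<later : ∀ {j k} → j ≢ P → j < k → suc k < n → f (suc j) < f (suc k)
  regular<later j≢P j<k k<n = regular-isRLMin j≢P (<-trans (s≤s j<k) k<n) k<n (s≤s j<k)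

  before-gap : ∀ {j} → j < P → f (suc j) ≡ j
  before-gap {zero}  0<P = n≤0⇒n≡0 (regular≤ (<⇒≢ 0<P) (<-trans (s≤s 0<P) P<n))
  before-gap {suc j} j<P = ≤-antisym (regular≤ (<⇒≢ j<P) (<-trans (s≤s j<P) P<n))
    (subst (_< f (suc (suc j))) (before-gap j′<P) (regular<later (<⇒≢ j′<P) ≤-refl (<-trans (s≤s j<P) P<n)))
    where
    j′<P : j < P
    j′<P = <-trans (n<1+n j) j<P

  after-gap≥ : ∀ {k} → P ≤ k → suc (suc k) < n → k ≤ f (suc (suc k))
  after-gap≥ {zero}  _ _ = z≤n
  after-gap≥ {suc k} P≤k k<n with P ≟ suc k
  ... | yes refl = subst (_< f (suc (suc (suc k)))) (before-gap ≤-refl)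
                     (regular<later (<⇒≢ ≤-refl) (<-trans (n<1+n k) (n<1+n (suc k))) k<n)
  ... | no  P≢k  = ≤-<-trans (after-gap≥ (s≤s⁻¹ (≤∧≢⇒< P≤k P≢k)) (<-trans (n<1+n _) k<n))
                     (regular<later (P≢k ∘ sym) ≤-refl k<n)

  after-gap : ∀ {k} → P ≤ k → suc (suc k) < n → f (suc (suc k)) ≡ k ⊎ f (suc (suc k)) ≡ suc k
  after-gap P≤k k<n with m≤n⇒m<n∨m≡n (regular≤ (>⇒≢ (s≤s P≤k)) k<n)
  ... | inj₁ f<1+k = inj₁ (≤-antisym (s≤s⁻¹ f<1+k) (after-gap≥ P≤k k<n))
  ... | inj₂ f≡1+k = inj₂ f≡1+k

  fixed-propagates : ∀ {k k′} → P ≤ k → k ≤ k′ → suc (suc k′) < n →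
                     f (suc (suc k)) ≡ suc k → f (suc (suc k′)) ≡ suc k′
  fixed-propagates P≤k k≤k′ k′<n fixed with m≤n⇒m<n∨m≡n k≤k′
  ... | inj₂ refl = fixed
  fixed-propagates {k′ = suc k′} P≤k _ k′<n fixed | inj₁ (s≤s k≤k′) =
    ≤-antisym (regular≤ (>⇒≢ (s≤s (≤-trans P≤k′ (n≤1+n _)))) k′<n)
      (subst (_< f (suc (suc (suc k′)))) (fixed-propagates P≤k k≤k′ (<-trans (n<1+n _) k′<n) fixed)
        (regular<later (>⇒≢ (s≤s P≤k′)) ≤-refl k′<n))
    where
    P≤k′ : P ≤ k′
    P≤k′ = ≤-trans P≤k k≤k′

  shifted-propagates : ∀ {k k′} → P ≤ k → k ≤ k′ → suc (suc k′) < n →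
                       f (suc (suc k′)) ≡ k′ → f (suc (suc k)) ≡ k
  shifted-propagates P≤k k≤k′ k′<n f≡k′ with after-gap P≤k (≤-<-trans (s≤s (s≤s k≤k′)) k′<n)
  ... | inj₁ f≡k = f≡k
  ... | inj₂ f≡1+k = ⊥-elim (1+n≢n (sym (fixed-propagates P≤k k≤k′ k′<n f≡1+k) ⟨ trans ⟩ f≡k′))

  -- Every other position holds a value below its own index, hence below n ∸ 1.
  top-at-corner : f 0 ≡ M ⊎ f (suc P) ≡ M
  top-at-corner with f 0 ≟ M | f (suc P) ≟ M
  ... | yes f0≡M | _          = inj₁ f0≡M
  ... | no  _    | yes fP≡M   = inj₂ fP≡M
  ... | no  f0≢M | no  fP≢M   = ⊥-elim (1+n≰n (injectiveBelow⇒≤ f below-top injective))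
    where
    below-top : ∀ {i} → i < n → f i < M
    below-top {i} i<n with position P i
    ... | origin      = ≤∧≢⇒< (s≤s⁻¹ (bounded i<n)) f0≢M
    ... | gap         = ≤∧≢⇒< (s≤s⁻¹ (bounded i<n)) fP≢M
    ... | regular j≢P = s≤s (≤-trans (regular≤ j≢P i<n) (s≤s⁻¹ (s≤s⁻¹ i<n)))

  module OtherCorner {c : ℕ} (c<M : c < M) (c-at-corner : f 0 ≡ c ⊎ f (suc P) ≡ c) where

    regular≢c : ∀ {j} → j ≢ P → suc j < n → f (suc j) ≢ c
    regular≢c j≢P j<n fj≡c = [
      (λ f0≡c → 1+n≢0 (injective j<n z<s (fj≡c ⟨ trans ⟩ sym f0≡c))) ,
      (λ fP≡c → j≢P (suc-injective (injective j<n P<n (fj≡c ⟨ trans ⟩ sym fP≡c)))) ]′ c-at-corner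

    shifted-below-c : ∀ {k} → P ≤ k → k < c → suc (suc k) < n → f (suc (suc k)) ≡ k
    shifted-below-c P≤k k<c k<n with after-gap P≤k k<n
    ... | inj₁ f≡k   = f≡k
    shifted-below-c P≤k (s≤s k≤c′) k<n | inj₂ f≡1+k =
      ⊥-elim (regular≢c (>⇒≢ (s≤s (≤-trans P≤k k≤c′))) (s≤s c<M)
                        (fixed-propagates P≤k k≤c′ (s≤s c<M) f≡1+k))

    gap≤c : P ≤ c
    gap≤c with c <? P
    ... | yes c<P = ⊥-elim (regular≢c (<⇒≢ c<P) (<-trans (s≤s c<P) P<n) (before-gap c<P))
    ... | no  c≮P = ≮⇒≥ c≮P

    fixed-above-c : ∀ {k} → P ≤ k → c ≤ k → suc (suc k) < n → f (suc (suc k)) ≡ suc k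
    fixed-above-c P≤k c≤k k<n with after-gap P≤k k<n
    ... | inj₂ f≡1+k = f≡1+k
    ... | inj₁ f≡k   = ⊥-elim (regular≢c (>⇒≢ (s≤s gap≤c)) (≤-<-trans (s≤s (s≤s c≤k)) k<n)
                                         (shifted-propagates gap≤c c≤k k<n f≡k))

    regular≡rest : ∀ {j} → j ≢ P → suc j < n → f (suc j) ≡ rest P c j
    regular≡rest j≢P j<n with region P c j≢P
    ... | before j<P      = before-gap j<P ⟨ trans ⟩ sym (rest-< {c = c} j<P)
    ... | shifted P≤k k<c = shifted-below-c P≤k k<c j<n ⟨ trans ⟩ sym (rest-shifted P≤k k<c)
    ... | after (s≤s P≤k) c<j@(s≤s c≤k) = fixed-above-c P≤k c≤k j<n ⟨ trans ⟩ sym (rest-> {P = P} c<j)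

    ≡family : ∀ {x y} → f 0 ≡ x → f (suc P) ≡ y → ∀ {i} → i < n → f i ≡ family x y P c i
    ≡family {x} {y} f0≡x fP≡y {i} i<n with position P i
    ... | origin      = f0≡x
    ... | gap         = fP≡y ⟨ trans ⟩ sym (family-gap x y P c)
    ... | regular j≢P = regular≡rest j≢P i<n ⟨ trans ⟩ sym (family-regular x y P c j≢P)

  forced : ∃ λ s → Valid m s × (∀ {i} → i < n → f i ≡ shapeFun m s i)
  forced with top-at-corner
  ... | inj₁ f0≡M = maxFirst P c , (2+P≤c , s≤s⁻¹ c<M) , ≡family f0≡M refl
    where
    c : ℕ
    c = f (suc P)
    c<M : c < M
    c<M = ≤∧≢⇒< (s≤s⁻¹ (bounded P<n)) λ c≡M → 1+n≢0 (injective P<n z<s (c≡M ⟨ trans ⟩ sym f0≡M))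
    open OtherCorner c<M (inj₂ refl)
    gap-isRLMin : c ≡ P → IsRLMinℕ n f (suc P)
    gap-isRLMin c≡P {suc (suc k)} k<n (s≤s P<1+k) = subst (_< f (suc (suc k))) (sym c≡P)
      (subst (P <_) (sym (fixed-above-c (s≤s⁻¹ P<1+k) (≤-reflexive c≡P ⟨ ≤-trans ⟩ s≤s⁻¹ P<1+k) k<n)) P<1+k)
    2+P≤c : 2 + P ≤ c
    2+P≤c with m≤n⇒m<n∨m≡n gap≤c
    ... | inj₁ P<c = ≤∧≢⇒< P<c (der P<n ∘ sym)
    ... | inj₂ P≡c = ⊥-elim (gap-¬isRLMin (gap-isRLMin (sym P≡c)))
  ... | inj₂ fP≡M = maxSecond P c , (1≤c , gap≤c , s≤s⁻¹ c<M , P≤m) , ≡family refl fP≡M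
    where
    c : ℕ
    c = f 0
    c<M : c < M
    c<M = ≤∧≢⇒< (s≤s⁻¹ (bounded z<s)) λ c≡M → 1+n≢0 (injective P<n z<s (fP≡M ⟨ trans ⟩ sym c≡M))
    open OtherCorner c<M (inj₁ refl)
    1≤c : 1 ≤ c
    1≤c = n≢0⇒n>0 (der z<s)
    P≤m : P ≤ m
    P≤m with m≤n⇒m<n∨m≡n (s≤s⁻¹ (s≤s⁻¹ P<n))
    ... | inj₁ P<1+m = s≤s⁻¹ P<1+m
    ... | inj₂ refl  = ⊥-elim (der P<n fP≡M)

-- Counting the shapes

-- The shapes valid for m + 1 but not for m.
newShapes newMaxSecond newMaxFirst : ℕ → List Shape
newMaxSecond m = map (λ P → maxSecond P (2 + m)) (upTo (2 + m))
newMaxFirst  m = map (λ P → maxFirst  P (2 + m)) (upTo (suc m))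
newShapes    m = maxSecond (suc m) (suc m) ∷ newMaxSecond m ++ newMaxFirst m

validShapes : ℕ → List Shape
validShapes zero    = maxSecond 0 1 ∷ []
validShapes (suc m) = validShapes m ++ newShapes m

valid-weaken : ∀ {m} s → Valid m s → Valid (suc m) s
valid-weaken (maxFirst  _ _) (P+2≤c , c≤1+m)             = P+2≤c , m≤n⇒m≤1+n c≤1+m
valid-weaken (maxSecond _ _) (1≤c , P≤c , c≤1+m , P≤m) = 1≤c , P≤c , m≤n⇒m≤1+n c≤1+m , m≤n⇒m≤1+n P≤m

newShapes-valid : ∀ {m s} → s ∈ newShapes m → Valid (suc m) s
newShapes-valid (here refl) = s≤s z≤n , ≤-refl , n≤1+n _ , ≤-refl
newShapes-valid {m} (there s∈) with ∈-++⁻ (newMaxSecond m) s∈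
... | inj₁ s∈ˡ with P , P∈ , refl ← ∈-map⁻ _ s∈ˡ =
  s≤s z≤n , m≤n⇒m≤1+n (s≤s⁻¹ (∈-upTo⁻ P∈)) , ≤-refl , s≤s⁻¹ (∈-upTo⁻ P∈)
... | inj₂ s∈ʳ with P , P∈ , refl ← ∈-map⁻ _ s∈ʳ = s≤s (s≤s (s≤s⁻¹ (∈-upTo⁻ P∈))) , ≤-refl

newShapes-¬valid : ∀ {m s} → s ∈ newShapes m → ¬ Valid m s
newShapes-¬valid (here refl) (_ , _ , _ , 1+m≤m) = 1+n≰n 1+m≤m
newShapes-¬valid {m} (there s∈) with ∈-++⁻ (newMaxSecond m) s∈
... | inj₁ s∈ˡ with _ , _ , refl ← ∈-map⁻ _ s∈ˡ = λ (_ , _ , 2+m≤1+m , _) → 1+n≰n 2+m≤1+m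
... | inj₂ s∈ʳ with _ , _ , refl ← ∈-map⁻ _ s∈ʳ = λ (_ , 2+m≤1+m) → 1+n≰n 2+m≤1+m

valid-suc : ∀ {m} s → Valid (suc m) s → Valid m s ⊎ s ∈ newShapes m
valid-suc {m} (maxFirst P c) (P+2≤c , c≤2+m) with m≤n⇒m<n∨m≡n c≤2+m
... | inj₁ c<2+m = inj₁ (P+2≤c , s≤s⁻¹ c<2+m)
... | inj₂ refl  = inj₂ (there (∈-++⁺ʳ (newMaxSecond m) (∈-map⁺ _ (∈-upTo⁺ (s≤s⁻¹ P+2≤c)))))
valid-suc {m} (maxSecond P c) (1≤c , P≤c , c≤2+m , P≤1+m) with m≤n⇒m<n∨m≡n c≤2+m
... | inj₂ refl  = inj₂ (there (∈-++⁺ˡ (∈-map⁺ _ (∈-upTo⁺ (s≤s P≤1+m)))))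
... | inj₁ c<2+m with m≤n⇒m<n∨m≡n P≤1+m
...   | inj₁ P<1+m = inj₁ (1≤c , P≤c , s≤s⁻¹ c<2+m , s≤s⁻¹ P<1+m)
...   | inj₂ refl  = inj₂ (here (cong (maxSecond (suc m)) (≤-antisym (s≤s⁻¹ c<2+m) P≤c)))

∈-validShapes : ∀ {m} s → Valid m s → s ∈ validShapes m
∈-validShapes {zero}  (maxFirst  _ _) (P+2≤c , c≤1) with s≤s () ← ≤-trans P+2≤c c≤1
∈-validShapes {zero}  (maxSecond 0 1) _ = here refl
∈-validShapes {zero}  (maxSecond _ 0) (() , _)
∈-validShapes {zero}  (maxSecond _ (suc (suc _))) (_ , _ , s≤s () , _)
∈-validShapes {zero}  (maxSecond (suc _) _) (_ , _ , _ , ())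
∈-validShapes {suc m} s valid = [ ∈-++⁺ˡ ∘ ∈-validShapes s , ∈-++⁺ʳ (validShapes m) ]′ (valid-suc s valid)

validShapes-valid : ∀ {m s} → s ∈ validShapes m → Valid m s
validShapes-valid {zero}  (here refl) = s≤s z≤n , z≤n , s≤s z≤n , z≤n
validShapes-valid {suc m} s∈ =
  [ valid-weaken _ ∘ validShapes-valid , newShapes-valid ]′ (∈-++⁻ (validShapes m) s∈)

newShapes-unique : ∀ m → Unique (newShapes m)
newShapes-unique m = Allₚ.¬Any⇒All¬ _ head∉ ∷ Unique.++⁺ (Unique.map⁺ maxSecond-injective (Unique.upTo⁺ _))
                                                  (Unique.map⁺ maxFirst-injective (Unique.upTo⁺ _)) disjoint
  where
  maxSecond-injective : ∀ {P Q c} → maxSecond P c ≡ maxSecond Q c → P ≡ Q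
  maxSecond-injective refl = refl
  maxFirst-injective : ∀ {P Q c} → maxFirst P c ≡ maxFirst Q c → P ≡ Q
  maxFirst-injective refl = refl
  head∉ : maxSecond (suc m) (suc m) ∉ newMaxSecond m ++ newMaxFirst m
  head∉ s∈ with ∈-++⁻ (newMaxSecond m) s∈
  ... | inj₁ s∈ˡ with _ , _ , eq ← ∈-map⁻ _ s∈ˡ = 1+n≢n (sym (cong otherOf eq))
  ... | inj₂ s∈ʳ with _ , _ , () ← ∈-map⁻ _ s∈ʳ
  disjoint : Disjoint (newMaxSecond m) (newMaxFirst m)
  disjoint (s∈ˡ , s∈ʳ) with _ , _ , refl ← ∈-map⁻ _ s∈ˡ with _ , _ , () ← ∈-map⁻ _ s∈ʳ

validShapes-unique : ∀ m → Unique (validShapes m)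
validShapes-unique zero    = [] ∷ []
validShapes-unique (suc m) = Unique.++⁺ (validShapes-unique m) (newShapes-unique m)
  λ (s∈old , s∈new) → newShapes-¬valid s∈new (validShapes-valid s∈old)

length-validShapes : ∀ m → length (validShapes m) ≡ m + suc m ^ 2
length-validShapes zero    = refl
length-validShapes (suc m) = begin
  length (validShapes m ++ newShapes m)                                ≡⟨ length-++ (validShapes m) ⟩
  length (validShapes m) + suc (length (newMaxSecond m ++ newMaxFirst m)) ≡⟨ cong₂ (λ a b → a + suc b) (length-validShapes m) length-new ⟩
  m + suc m ^ 2 + suc (2 + m + suc m)                                  ≡⟨ square-step m ⟩
  suc m + suc (suc m) ^ 2                                              ∎
  where
  open ≡-Reasoning
  -- _^_ unfolded, since the ring solver does not recognise it
  square-step : ∀ m → m + suc m * (suc m * 1) + suc (2 + m + suc m) ≡ suc m + (2 + m) * ((2 + m) * 1)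
  square-step = ℕ-Solver.solve-∀
  length-new : length (newMaxSecond m ++ newMaxFirst m) ≡ 2 + m + suc m
  length-new = length-++ (newMaxSecond m) ⟨ trans ⟩ cong₂ _+_
    (length-map _ (upTo (2 + m)) ⟨ trans ⟩ length-upTo (2 + m))
    (length-map _ (upTo (suc m)) ⟨ trans ⟩ length-upTo (suc m))

module Enumeration (m : ℕ) where

  private
    n : ℕ
    n = 3 + m

  encode : Shape → Vec (Fin n) n
  encode s = fromFun n (shapeFun m s)

  toℕ-lookup-encode : ∀ {s} → Valid m s → ∀ k → toℕ (lookup (encode s) k) ≡ shapeFun m s (toℕ k)
  toℕ-lookup-encode {s} valid = toℕ-lookup-fromFun (ShapeFunProperties.bounded m s valid)

  encodings : List (Vec (Fin n) n)
  encodings = map encode (validShapes m)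

  encode-counted : ∀ {s} → Valid m s → IsCounted n (suc m) (encode s)
  encode-counted {s} valid =
    R.isPerm S.injective , R.isDerangement S.isDerangementℕ , suc-injective (rlmin≡ σ ¬min₀ (fromℕ< P<) ¬minₚ minᵢ)
    where
    σ : Vec (Fin n) n
    σ = encode s
    module S = ShapeFunProperties m s valid
    module R = Represents σ (shapeFun m s) (toℕ-lookup-encode valid)
    ¬min₀ : ¬ IsRLMinAt σ zero
    ¬min₀ = ¬isRLMinℕ-zero S.isPermℕ S.isDerangementℕ z<s ∘ R.isRLMinℕ
    P< : gapOf s < 2 + m
    P< = s≤s⁻¹ (1+gap<n s valid)
    ¬minₚ : ¬ IsRLMinAt σ (suc (fromℕ< P<))
    ¬minₚ = S.gap-¬isRLMin ∘ subst (IsRLMinℕ n (shapeFun m s) ∘ suc) (toℕ-fromℕ< P<) ∘ R.isRLMinℕ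
    minᵢ : ∀ i → i ≢ fromℕ< P< → IsRLMinAt σ (suc i)
    minᵢ i i≢P = R.isRLMinAt (S.regular-isRLMin λ i≡P → i≢P (toℕ-injective (i≡P ⟨ trans ⟩ sym (toℕ-fromℕ< P<))))

  counted-encoding : ∀ {σ} → IsCounted n (suc m) σ → ∃ λ s → Valid m s × σ ≡ encode s
  counted-encoding {σ} (σ-perm , σ-der , σ-rlmin) = from-gap (rlmin≡⁻ σ ¬min₀ (cong suc σ-rlmin))
    where
    f : ℕ → ℕ
    f = toFun σ
    open Represents σ f (toℕ-lookup-toFun σ)
    perm : IsPermℕ n f
    perm = isPermℕ σ-perm
    der : IsDerangementℕ n f
    der = isDerangementℕ σ-der
    ¬min₀ : ¬ IsRLMinAt σ zero
    ¬min₀ = ¬isRLMinℕ-zero perm der z<s ∘ isRLMinℕ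
    from-gap : (∃ λ p → ¬ IsRLMinAt σ (suc p) × (∀ i → i ≢ p → IsRLMinAt σ (suc i))) →
               ∃ λ s → Valid m s × σ ≡ encode s
    from-gap (p , ¬minₚ , minᵢ) =
      let s , valid , f≗s = ForcedShape.forced m {f} perm der (s≤s (toℕ<n p)) (¬minₚ ∘ isRLMinAt) regular-min
      in  s , valid , ≡fromFun σ {shapeFun m s} λ k → toℕ-lookup-toFun σ k ⟨ trans ⟩ f≗s (toℕ<n k)
      where
      regular-min : ∀ {j} → j ≢ toℕ p → suc j < n → IsRLMinℕ n f (suc j)
      regular-min j≢P j<n = subst (IsRLMinℕ n f ∘ suc) (toℕ-fromℕ< (s≤s⁻¹ j<n))
        (isRLMinℕ (minᵢ _ λ i≡p → j≢P (sym (toℕ-fromℕ< (s≤s⁻¹ j<n)) ⟨ trans ⟩ cong toℕ i≡p)))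

  encodings-unique : Unique encodings
  encodings-unique = map⁺-uniqueOn encode-injective (validShapes-unique m)
    where
    encode-injective : ∀ {s s′} → s ∈ validShapes m → s′ ∈ validShapes m → encode s ≡ encode s′ → s ≡ s′
    encode-injective {s} {s′} s∈ s′∈ eq = shapeFun-injective s s′ v v′ λ i<n →
      shapeFun≡lookup v i<n ⟨ trans ⟩ cong (λ σ → toℕ (lookup σ (fromℕ< i<n))) eq
      ⟨ trans ⟩ sym (shapeFun≡lookup v′ i<n)
      where
      v : Valid m s
      v = validShapes-valid s∈
      v′ : Valid m s′
      v′ = validShapes-valid s′∈
      shapeFun≡lookup : ∀ {s} → Valid m s → ∀ {i} (i<n : i < n) →
                        shapeFun m s i ≡ toℕ (lookup (encode s) (fromℕ< i<n))
      shapeFun≡lookup {s} v = Represents.f≡lookup (encode s) (shapeFun m s) (toℕ-lookup-encode v)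

  d≡ : d n (suc m) ≡ m + suc m ^ 2
  d≡ = begin
    d n (suc m)       ≡⟨ length-filter≡length-enumeration (isCounted? n (suc m))
                           (allVecs-unique n n) ∈-allVecs encodings-unique sound complete ⟩
    length encodings  ≡⟨ length-map encode (validShapes m) ⟩
    length (validShapes m) ≡⟨ length-validShapes m ⟩
    m + suc m ^ 2     ∎
    where
    open ≡-Reasoning
    sound : ∀ {σ} → σ ∈ encodings → IsCounted n (suc m) σ
    sound σ∈ = let _ , s∈ , σ≡ = ∈-map⁻ encode σ∈ in
      subst (IsCounted n (suc m)) (sym σ≡) (encode-counted (validShapes-valid s∈))
    complete : ∀ {σ} → IsCounted n (suc m) σ → σ ∈ encodings
    complete counted = let s , valid , σ≡ = counted-encoding counted in
      subst (_∈ encodings) (sym σ≡) (∈-map⁺ encode (∈-validShapes s valid))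

d-formula : (n : ℕ) → 3 ≤ n → d n (n ∸ 2) ≡ (n ∸ 3) + (n ∸ 2) ^ 2
d-formula (suc (suc (suc m))) _ = Enumeration.d≡ m
d-formula (suc (suc zero)) (s≤s (s≤s ()))
d-formula (suc zero)       (s≤s ())

-- The generating function

*ₛ-congʳ : ∀ (f : FPS) {g h : FPS} → (∀ i → g i ≡ h i) → ∀ m → (f *ₛ g) m ≡ (f *ₛ h) m
*ₛ-congʳ f g≗h m = cong (foldr ℤ._+_ 0ℤ) (map-cong (λ i → cong (f i ℤ.*_) (g≗h (m ∸ i))) (upTo (suc m)))

sum-zeros : ∀ (F : ℕ → ℤ) {is} → All (λ i → F i ≡ 0ℤ) is → foldr ℤ._+_ 0ℤ (map F is) ≡ 0ℤ
sum-zeros F []            = refl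
sum-zeros F (Fi≡0 ∷ Fis≡0) = cong₂ ℤ._+_ Fi≡0 (sum-zeros F Fis≡0)

[1-x]³ 1+2x-x² : FPS
[1-x]³  = poly (+ 1 ∷ - (+ 3) ∷ + 3 ∷ - (+ 1) ∷ [])
1+2x-x² = poly (+ 1 ∷ + 2 ∷ - (+ 1) ∷ [])

d-closedForm : ℤ → ℤ
d-closedForm x = x ℤ.+ (1ℤ ℤ.+ x) ℤ.* (1ℤ ℤ.+ x)

Dseries≡d-closedForm : ∀ j → Dseries j ≡ d-closedForm (+ j)
Dseries≡d-closedForm j = begin
  + d (j + 3) (suc j)         ≡⟨ cong (λ k → + d k (suc j)) (+-comm j 3) ⟩
  + d (3 + j) (suc j)         ≡⟨ cong +_ (d-formula (3 + j) (s≤s (s≤s (s≤s z≤n)))) ⟩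
  + (j + suc j ^ 2)           ≡⟨ pos-+ j (suc j ^ 2) ⟩
  + j ℤ.+ + (suc j ^ 2)       ≡⟨ cong (λ k → + j ℤ.+ + (suc j * k)) (*-identityʳ (suc j)) ⟩
  + j ℤ.+ + (suc j * suc j)   ≡⟨ cong (ℤ._+_ (+ j)) (pos-* (suc j) (suc j)) ⟩
  d-closedForm (+ j)          ∎
  where open ≡-Reasoning

-- The third difference of the quadratic d-closedForm (spelled out for the ring
-- solver) vanishes; t stands for the higher terms of the Cauchy product, which
-- are all zero.
third-difference : ∀ x t → let q = λ y → y ℤ.+ (1ℤ ℤ.+ y) ℤ.* (1ℤ ℤ.+ y) in
  + 1 ℤ.* q (+ 3 ℤ.+ x) ℤ.+ (- (+ 3) ℤ.* q (+ 2 ℤ.+ x) ℤ.+ (+ 3 ℤ.* q (+ 1 ℤ.+ x) ℤ.+ (- (+ 1) ℤ.* q x ℤ.+ t)))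
  ≡ t
third-difference = ℤ-Solver.solve-∀

[1-x]³*d-closedForm : ∀ m → ([1-x]³ *ₛ (d-closedForm ∘ +_)) m ≡ 1+2x-x² m
[1-x]³*d-closedForm 0 = refl
[1-x]³*d-closedForm 1 = refl
[1-x]³*d-closedForm 2 = refl
[1-x]³*d-closedForm (suc (suc (suc r))) =
  third-difference (+ r) _ ⟨ trans ⟩ sum-zeros _ (Allₚ.applyUpTo⁺₂ _ r λ _ → refl)

Dseries-closedForm : ∀ m → ([1-x]³ *ₛ Dseries) m ≡ 1+2x-x² m
Dseries-closedForm m = *ₛ-congʳ [1-x]³ Dseries≡d-closedForm m ⟨ trans ⟩ [1-x]³*d-closedForm m

proposition3p7 : ((n : ℕ) → 3 ≤ n → d n (n ∸ 2) ≡ (n ∸ 3) + (n ∸ 2) ^ 2)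
    × ((m : ℕ) → (poly (+ 1 ∷ - (+ 3) ∷ + 3 ∷ - (+ 1) ∷ []) *ₛ Dseries) m
         ≡ poly (+ 1 ∷ + 2 ∷ - (+ 1) ∷ []) m)
proposition3p7 = d-formula , Dseries-closedForm
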